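{- Let $\Sigma$ be a signature consisting of relation-algebra operations and containing inclusion $\subseteq$ (abstractly $\leq$), complement $\setminus$ (abstractly $-$) and composition $;$ (abstractly $\circ$). Then $R(\Sigma)$ fails to have the finite representation property: there is a finite structure in $R(\Sigma)$ which has no representation over a finite base set.
   Context: Composition of binary relations: $R;S=\{(x,y):\exists z\,((x,z)\in R\wedge(z,y)\in S)\}$. For a $(\leq,-,\circ)$-structure $\mathcal{S}$, a $(\subseteq,\setminus,;)$-representation of $\mathcal{S}$ over a base set $X$ is a map $\theta:\mathcal{S}\to\wp(X\times X)$ such that for all $a,b\in\mathcal{S}$: (i) $a\leq b\Rightarrow a^\theta\subseteq b^\theta$; (ii) if $(x,y)\in a^\theta$ then $(x,y)$ lies in the symmetric difference of $b^\theta$ and $(-b)^\theta$ (so $-$ is represented as complement relative to the union of all represented relations); (iii) $(x,y)\in(a\circ b)^\theta\iff\exists z\,((x,z)\in a^\theta\wedge(z,y)\in b^\theta)$. For a signature $\Sigma$ expanding $(\leq,-,\circ)$ by further relation-algebra operations, a $\Sigma$-representation is such a map that additionally interprets the remaining operations by their standard set-theoretic meanings; $R(\Sigma)$ is the class of $\Sigma$-structures having a $\Sigma$-representation. The finite representation property for $R(\Sigma)$ means every finite structure in $R(\Sigma)$ has a representation over a finite base. -}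

module Defs where

open import Data.Bool using (Bool; true; false)
open import Data.Unit using (⊤)
open import Data.Nat using (ℕ)
open import Data.Fin using (Fin)
open import Data.Product using (Σ; Σ-syntax; ∃; ∃-syntax; _×_)
open import Data.Sum using (_⊎_)
open import Relation.Nullary using (¬_)
open import Relation.Binary.PropositionalEquality using (_≡_)
open import Function.Bundles using (_⇔_)

-- A signature Σ of relation-algebra operations that always contains
-- ≤ (inclusion), - (complement) and ∘ (composition); each flag says
-- whether the corresponding further relation-algebra operation is in Σ:
-- join (+, union), meet (·, intersection), converse (˘), zero (0, empty),
-- top (1, greatest relation), identity (1', diagonal).
record Signature : Set where
  field
    hasJoin hasMeet hasConv hasZero hasTop hasIdent : Bool

Opt : Bool → Set → Set
Opt true  A = A
Opt false A = ⊤

Law : (b : Bool) {A : Set} → (A → Set) → Opt b A → Set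
Law true  P f = P f
Law false P _ = ⊤

record Structure (sig : Signature) : Set₁ where
  open Signature sig
  field
    size  : ℕ
    _≤_   : Fin size → Fin size → Set
    -_    : Fin size → Fin size
    _∘_   : Fin size → Fin size → Fin size
    join  : Opt hasJoin  (Fin size → Fin size → Fin size)
    meet  : Opt hasMeet  (Fin size → Fin size → Fin size)
    conv  : Opt hasConv  (Fin size → Fin size)
    zero  : Opt hasZero  (Fin size)
    top   : Opt hasTop   (Fin size)
    ident : Opt hasIdent (Fin size)

record IsRepresentation {sig : Signature} (S : Structure sig) (X : Set)
                        (θ : Fin (Structure.size S) → X → X → Set) : Set where
  open Signature sig
  open Structure S
  field
    rep-≤ : ∀ a b → (a ≤ b) ⇔ (∀ x y → θ a x y → θ b x y)
    rep-- : ∀ a b x y → θ a x y →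
              (θ b x y × ¬ θ (- b) x y) ⊎ (¬ θ b x y × θ (- b) x y)
    rep-∘ : ∀ a b x y → θ (a ∘ b) x y ⇔ (∃[ z ] (θ a x z × θ b z y))
    rep-join  : Law hasJoin  (λ j → ∀ a b x y → θ (j a b) x y ⇔ (θ a x y ⊎ θ b x y)) join
    rep-meet  : Law hasMeet  (λ m → ∀ a b x y → θ (m a b) x y ⇔ (θ a x y × θ b x y)) meet
    rep-conv  : Law hasConv  (λ c → ∀ a x y → θ (c a) x y ⇔ θ a y x) conv
    rep-zero  : Law hasZero  (λ z → ∀ x y → ¬ θ z x y) zero
    -- the top is the union of all represented relations (the relation
    -- relative to which complement is taken)
    rep-top   : Law hasTop   (λ t → ∀ x y → θ t x y ⇔ (∃[ a ] θ a x y)) top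
    rep-ident : Law hasIdent (λ i → ∀ x y → θ i x y ⇔ (x ≡ y)) ident

-- S ∈ R(Σ): S has a representation over some base set.
Representable : {sig : Signature} → Structure sig → Set₁
Representable S =
  Σ[ X ∈ Set ] Σ[ θ ∈ (Fin (Structure.size S) → X → X → Set) ] IsRepresentation S X θ

FinitelyRepresentable : {sig : Signature} → Structure sig → Set₁
FinitelyRepresentable S =
  Σ[ m ∈ ℕ ] Σ[ θ ∈ (Fin (Structure.size S) → Fin m → Fin m → Set) ]
    IsRepresentation S (Fin m) θ

{-# OPTIONS --safe #-}
-- The witness is the point algebra: the complex algebra of the three atoms <, =, > of a
-- dense linear order without endpoints.  Sending a set of atoms to the union of the
-- corresponding relations on ℚ represents it, whatever further operations Σ contains.
-- Conversely, in any representation the element < denotes a nonempty, transitive, dense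
-- relation, which is irreflexive because = is a unit for < and disjoint from it.  Iterating
-- density from one pair yields an infinite strictly increasing chain, so the base cannot be
-- finite.
module Submission where

open import Defs
open import Data.Product using (Σ-syntax; _×_; ∃-syntax; ∃₂; _,_; proj₁; proj₂; map₂)
open import Relation.Nullary using (¬_)

open import Data.Bool using (Bool; true; false)
open import Data.Bool.Properties using (T-≡)
open import Data.Empty using (⊥-elim)
open import Data.Fin using (Fin; zero; suc; toℕ; finToFun; funToFin)
open import Data.Fin.Properties using (2↔Bool; finToFun-funToFin; any?; pigeonhole)
open import Data.Fin.Subset using (Subset; _∈_; _∉_; _⊆_; ∁; _∪_; _∩_; ⁅_⁆)
  renaming (⊥ to ∅; ⊤ to full)
open import Data.Fin.Subset.Properties
  using (_∈?_; _⊆?_; ∉⊥; ∈⊤; x∈⁅y⁆⇔x≡y; x∈p∪q⁺; x∈p∪q⁻; x∈p∩q⁺; x∈p∩q⁻; x∈p⇒x∉∁p; x∉p⇒x∈∁p)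
open import Data.Nat as ℕ using (ℕ; _^_; _<′_; <′-base; <′-step)
open import Data.Nat.Properties using (n<1+n; <⇒<′)
open import Data.Rational using (ℚ; 0ℚ; 1ℚ; _+_; _-_)
  renaming (_<_ to _<ℚ_; -_ to -ℚ_)
import Data.Rational.Properties as ℚ
open import Data.Sum using (_⊎_; inj₁; inj₂)
open import Data.Vec using (tabulate; lookup)
open import Data.Vec.Properties
  using (tabulate-cong; tabulate∘lookup; lookup∘tabulate; []=⇒lookup; lookup⇒[]=)
open import Function using (_∘′_)
open import Function.Bundles using (_⇔_; mk⇔; Inverse; Equivalence)
open import Function.Construct.Composition using (_⇔-∘_)
import Function.Properties.Equivalence as ⇔
open import Level using (Level)
open import Relation.Binary using (Rel; Transitive; Irreflexive; Dense; tri<; tri≈; tri>)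
open import Relation.Binary.Structures using (IsDenseLinearOrder)
open import Relation.Binary.PropositionalEquality
  using (_≡_; refl; sym; trans; cong; subst; module ≡-Reasoning)
open import Relation.Nullary.Decidable
  using (yes; no; isYes; True; False; toWitness; toWitnessFalse; fromWitness; _×-dec_)
open import Relation.Unary using (Pred; Decidable)

open Equivalence using (to; from)

private
  variable
    ℓ : Level
    k m : ℕ

-- Structure demands the carrier Fin size, so sets of k atoms are coded by Fin (2 ^ k).
module SubsetCode (k : ℕ) where

  toSubset : Fin (2 ^ k) → Subset k
  toSubset i = tabulate (Inverse.to 2↔Bool ∘′ finToFun i)

  fromSubset : Subset k → Fin (2 ^ k)
  fromSubset p = funToFin (Inverse.from 2↔Bool ∘′ lookup p)

  toSubset-fromSubset : (p : Subset k) → toSubset (fromSubset p) ≡ p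
  toSubset-fromSubset p = begin
    tabulate (Inverse.to 2↔Bool ∘′ finToFun (fromSubset p))
      ≡⟨ tabulate-cong (λ a → cong (Inverse.to 2↔Bool) (finToFun-funToFin _ a)) ⟩
    tabulate (Inverse.to 2↔Bool ∘′ Inverse.from 2↔Bool ∘′ lookup p)
      ≡⟨ tabulate-cong (λ a → Inverse.strictlyInverseˡ 2↔Bool (lookup p a)) ⟩
    tabulate (lookup p)
      ≡⟨ tabulate∘lookup p ⟩
    p ∎
    where open ≡-Reasoning

  ∈-fromSubset : ∀ {a} {p : Subset k} → a ∈ toSubset (fromSubset p) ⇔ a ∈ p
  ∈-fromSubset {a = a} {p} =
    mk⇔ (subst (a ∈_) (toSubset-fromSubset p)) (subst (a ∈_) (sym (toSubset-fromSubset p)))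

  ∈⊎∈-fromSubset-∁ : ∀ a p →
    (a ∈ p × a ∉ toSubset (fromSubset (∁ p))) ⊎ (a ∉ p × a ∈ toSubset (fromSubset (∁ p)))
  ∈⊎∈-fromSubset-∁ a p with a ∈? p
  ... | yes a∈p = inj₁ (a∈p , x∈p⇒x∉∁p a∈p ∘′ to ∈-fromSubset)
  ... | no  a∉p = inj₂ (a∉p , from ∈-fromSubset (x∉p⇒x∈∁p a∉p))

∈-tabulate : {f : Fin k → Bool} {a : Fin k} → a ∈ tabulate f ⇔ f a ≡ true
∈-tabulate {f = f} {a} = mk⇔
  (λ a∈ → trans (sym (lookup∘tabulate f a)) ([]=⇒lookup a∈))
  (λ fa≡true → lookup⇒[]= a _ (trans (lookup∘tabulate f a) fa≡true))

｛_｝ : {P : Pred (Fin k) ℓ} → Decidable P → Subset k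
｛ P? ｝ = tabulate (λ a → isYes (P? a))

∈-｛｝ : {P : Pred (Fin k) ℓ} (P? : Decidable P) {a : Fin k} → a ∈ ｛ P? ｝ ⇔ P a
∈-｛｝ P? {a} = mk⇔ (toWitness {a? = P? a}) fromWitness ⇔-∘ (⇔.sym T-≡ ⇔-∘ ∈-tabulate)

optional : (b : Bool) {A : Set} → A → Opt b A
optional true  a = a
optional false _ = _

optional-law : (b : Bool) {A : Set} {P : A → Set} {a : A} → P a → Law b P (optional b a)
optional-law true  pa = pa
optional-law false _  = _

record AtomStructure (k : ℕ) : Set where
  field
    _⨾_ : Fin k → Fin k → Subset k
    _˘  : Fin k → Fin k
    ι   : Fin k

-- atom x y is the unique atom containing the pair (x , y).
record IsAtomRepresentation (At : AtomStructure k) {X : Set} (atom : X → X → Fin k) : Set where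
  open AtomStructure At
  field
    atom-surjective : ∀ a → ∃₂ λ x y → atom x y ≡ a
    atom-⨾ : ∀ a b x y → atom x y ∈ a ⨾ b ⇔ (∃[ z ] (atom x z ≡ a × atom z y ≡ b))
    atom-˘ : ∀ x y → atom y x ≡ atom x y ˘
    atom-ι : ∀ x y → atom x y ≡ ι ⇔ x ≡ y

module ComplexAlgebra (At : AtomStructure k) where
  open AtomStructure At
  open SubsetCode k

  _⨾*_ : Subset k → Subset k → Subset k
  p ⨾* q = ｛ (λ c → any? λ a → any? λ b → a ∈? p ×-dec b ∈? q ×-dec c ∈? a ⨾ b) ｝

  _˘* : Subset k → Subset k
  p ˘* = ｛ (λ c → (c ˘) ∈? p) ｝

  complexAlgebra : (sig : Signature) → Structure sig
  complexAlgebra sig = record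
    { size  = 2 ^ k
    ; _≤_   = λ i j → toSubset i ⊆ toSubset j
    ; -_    = lift₁ ∁
    ; _∘_   = lift₂ _⨾*_
    ; join  = optional hasJoin (lift₂ _∪_)
    ; meet  = optional hasMeet (lift₂ _∩_)
    ; conv  = optional hasConv (lift₁ _˘*)
    ; zero  = optional hasZero (fromSubset ∅)
    ; top   = optional hasTop (fromSubset full)
    ; ident = optional hasIdent (fromSubset ⁅ ι ⁆)
    }
    where
    open Signature sig
    lift₁ : (Subset k → Subset k) → Fin (2 ^ k) → Fin (2 ^ k)
    lift₁ f i = fromSubset (f (toSubset i))
    lift₂ : (Subset k → Subset k → Subset k) → Fin (2 ^ k) → Fin (2 ^ k) → Fin (2 ^ k)
    lift₂ f i j = fromSubset (f (toSubset i) (toSubset j))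

  module _ {X : Set} {atom : X → X → Fin k} (rep : IsAtomRepresentation At atom) where
    open IsAtomRepresentation rep

    ⟦_⟧ : Fin (2 ^ k) → X → X → Set
    ⟦ i ⟧ x y = atom x y ∈ toSubset i

    ⊆⇔atomwise : {p q : Subset k} → p ⊆ q ⇔ (∀ x y → atom x y ∈ p → atom x y ∈ q)
    ⊆⇔atomwise {p} {q} = mk⇔ (λ p⊆q x y → p⊆q {atom x y}) atomwise⇒⊆
      where
      atomwise⇒⊆ : (∀ x y → atom x y ∈ p → atom x y ∈ q) → p ⊆ q
      atomwise⇒⊆ h {a} a∈p with atom-surjective a
      ... | x , y , refl = h x y a∈p

    ∈-⨾* : ∀ {p q} x y → atom x y ∈ p ⨾* q ⇔ (∃[ z ] (atom x z ∈ p × atom z y ∈ q))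
    ∈-⨾* {p} {q} x y = mk⇔ split combine ⇔-∘ ∈-｛｝ _
      where
      split : ∃[ a ] ∃[ b ] (a ∈ p × b ∈ q × atom x y ∈ a ⨾ b) →
              ∃[ z ] (atom x z ∈ p × atom z y ∈ q)
      split (a , b , a∈p , b∈q , xy∈a⨾b) with to (atom-⨾ a b x y) xy∈a⨾b
      ... | z , refl , refl = z , a∈p , b∈q
      combine : ∃[ z ] (atom x z ∈ p × atom z y ∈ q) →
                ∃[ a ] ∃[ b ] (a ∈ p × b ∈ q × atom x y ∈ a ⨾ b)
      combine (z , xz∈p , zy∈q) =
        atom x z , atom z y , xz∈p , zy∈q , from (atom-⨾ _ _ x y) (z , refl , refl)

    ∈-˘* : ∀ {p} x y → atom x y ∈ p ˘* ⇔ atom y x ∈ p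
    ∈-˘* {p} x y = mk⇔ (subst (_∈ p) (sym (atom-˘ x y))) (subst (_∈ p) (atom-˘ x y)) ⇔-∘ ∈-｛｝ _

    isRepresentation : (sig : Signature) → IsRepresentation (complexAlgebra sig) X ⟦_⟧
    isRepresentation sig = record
      { rep-≤     = λ _ _ → ⊆⇔atomwise
      -- every pair lies in the relation of some atom, so complements are absolute
      ; rep--     = λ _ b x y _ → ∈⊎∈-fromSubset-∁ (atom x y) (toSubset b)
      ; rep-∘     = λ _ _ x y → ∈-⨾* x y ⇔-∘ ∈-fromSubset
      ; rep-join  = optional-law hasJoin λ _ _ _ _ → mk⇔ (x∈p∪q⁻ _ _) x∈p∪q⁺ ⇔-∘ ∈-fromSubset
      ; rep-meet  = optional-law hasMeet λ _ _ _ _ → mk⇔ (x∈p∩q⁻ _ _) x∈p∩q⁺ ⇔-∘ ∈-fromSubset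
      ; rep-conv  = optional-law hasConv λ _ x y → ∈-˘* x y ⇔-∘ ∈-fromSubset
      ; rep-zero  = optional-law hasZero λ _ _ → ∉⊥ ∘′ to ∈-fromSubset
      ; rep-top   = optional-law hasTop λ _ _ → mk⇔ (_ ,_) (λ _ → from ∈-fromSubset ∈⊤)
      ; rep-ident = optional-law hasIdent λ x y → atom-ι x y ⇔-∘ (x∈⁅y⁆⇔x≡y ⇔-∘ ∈-fromSubset)
      }
      where
      open Signature sig

module _ {sig : Signature} {S : Structure sig} {X : Set} {θ : Fin (Structure.size S) → X → X → Set}
         (R : IsRepresentation S X θ) where
  open Structure S
  open IsRepresentation R

  ≤-compose : ∀ {a b c x y z} → (a ∘ b) ≤ c → θ a x y → θ b y z → θ c x z
  ≤-compose {a} {b} {c} {x} {y} {z} ab≤c axy byz =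
    to (rep-≤ (a ∘ b) c) ab≤c x z (from (rep-∘ a b x z) (y , axy , byz))

  ≤-decompose : ∀ {a b c x y} → c ≤ (a ∘ b) → θ c x y → ∃[ z ] (θ a x z × θ b z y)
  ≤-decompose {a} {b} {c} {x} {y} c≤ab cxy =
    to (rep-∘ a b x y) (to (rep-≤ c (a ∘ b)) c≤ab x y cxy)

  ≤-complement⇒disjoint : ∀ {a b x y} → a ≤ (- b) → θ a x y → ¬ θ b x y
  ≤-complement⇒disjoint {a} {b} {x} {y} a≤-b axy bxy with rep-- a b x y axy
  ... | inj₁ (_ , ¬-bxy) = ¬-bxy (to (rep-≤ a (- b)) a≤-b x y axy)
  ... | inj₂ (¬bxy , _) = ¬bxy bxy

  ≰⇒nonempty : ∀ {a b} → ¬ a ≤ b → ¬ (∀ x y → ¬ θ a x y)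
  ≰⇒nonempty {a} {b} a≰b empty = a≰b (from (rep-≤ a b) λ x y axy → ⊥-elim (empty x y axy))

module _ {R : Rel (Fin m) ℓ}
         (R-trans : Transitive R) (R-irrefl : Irreflexive _≡_ R) (R-dense : Dense R) where

  dense-strict-order-on-Fin-is-empty : ∀ {x y} → ¬ R x y
  dense-strict-order-on-Fin-is-empty {x} {y} xRy =
    let i , j , i<j , pᵢ≡pⱼ = pigeonhole (n<1+n m) (point ∘′ toℕ) in
    R-irrefl pᵢ≡pⱼ (chain (<⇒<′ i<j))
    where
    descent : ℕ → ∃[ z ] R z y
    descent ℕ.zero = x , xRy
    descent (ℕ.suc n) = map₂ proj₂ (R-dense (proj₂ (descent n)))
    point : ℕ → Fin m
    point = proj₁ ∘′ descent
    link : ∀ n → R (point n) (point (ℕ.suc n))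
    link n = proj₁ (proj₂ (R-dense (proj₂ (descent n))))
    chain : ∀ {i j} → i <′ j → R (point i) (point j)
    chain {i} <′-base = link i
    chain {j = ℕ.suc j} (<′-step i<j) = R-trans (chain i<j) (link j)

module _ {sig : Signature} (S : Structure sig) where
  open Structure S

  -- Without 1' in Σ the diagonal need not be represented; e replaces it in showing that
  -- r is irreflexive.
  no-finite-representation : ∀ r e → r ≤ (r ∘ r) → (r ∘ r) ≤ r →
    r ≤ (e ∘ r) → (r ∘ e) ≤ r → e ≤ (- r) → ¬ r ≤ (- r) → ¬ FinitelyRepresentable S
  no-finite-representation r e r-dense r-trans e-left e-right e-disjoint r≰-r (m , θ , R) =
    ≰⇒nonempty R r≰-r λ x y →
      dense-strict-order-on-Fin-is-empty (≤-compose R r-trans) irreflexive (≤-decompose R r-dense)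
    where
    irreflexive : Irreflexive _≡_ (θ r)
    irreflexive refl rxx =
      let w , exw , _ = ≤-decompose R e-left rxx in
      ≤-complement⇒disjoint R e-disjoint exw (≤-compose R e-right rxx exw)

pattern lt = zero
pattern eq = suc zero
pattern gt = suc (suc zero)

pointAtoms : AtomStructure 3
pointAtoms = record { _⨾_ = compose ; _˘ = converse ; ι = eq }
  where
  compose : Fin 3 → Fin 3 → Subset 3
  compose a  eq = ⁅ a ⁆
  compose eq b  = ⁅ b ⁆
  compose lt lt = ⁅ lt ⁆
  compose gt gt = ⁅ gt ⁆
  compose lt gt = full
  compose gt lt = full
  converse : Fin 3 → Fin 3
  converse lt = gt
  converse eq = eq
  converse gt = lt

module UnboundedDenseLinearOrder
  {X : Set} {_<_ : Rel X ℓ} (isDLO : IsDenseLinearOrder _≡_ _<_)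
  (x₀ : X) (no-max : ∀ x → ∃[ z ] x < z) (no-min : ∀ x → ∃[ z ] z < x) where
  open IsDenseLinearOrder isDLO using (compare; dense) renaming (trans to <-trans)
  open AtomStructure pointAtoms

  order : X → X → Fin 3
  order x y with compare x y
  ... | tri< _ _ _ = lt
  ... | tri≈ _ _ _ = eq
  ... | tri> _ _ _ = gt

  order≡lt : ∀ {x y} → order x y ≡ lt ⇔ x < y
  order≡lt {x} {y} with compare x y
  ... | tri< x<y _ _ = mk⇔ (λ _ → x<y) (λ _ → refl)
  ... | tri≈ x≮y _ _ = mk⇔ (λ ()) (⊥-elim ∘′ x≮y)
  ... | tri> x≮y _ _ = mk⇔ (λ ()) (⊥-elim ∘′ x≮y)

  order≡eq : ∀ {x y} → order x y ≡ eq ⇔ x ≡ y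
  order≡eq {x} {y} with compare x y
  ... | tri< _ x≢y _ = mk⇔ (λ ()) (⊥-elim ∘′ x≢y)
  ... | tri≈ _ x≡y _ = mk⇔ (λ _ → x≡y) (λ _ → refl)
  ... | tri> _ x≢y _ = mk⇔ (λ ()) (⊥-elim ∘′ x≢y)

  order≡gt : ∀ {x y} → order x y ≡ gt ⇔ y < x
  order≡gt {x} {y} with compare x y
  ... | tri< _ _ y≮x = mk⇔ (λ ()) (⊥-elim ∘′ y≮x)
  ... | tri≈ _ _ y≮x = mk⇔ (λ ()) (⊥-elim ∘′ y≮x)
  ... | tri> _ _ y<x = mk⇔ (λ _ → y<x) (λ _ → refl)

  order-˘ : ∀ x y → order y x ≡ order x y ˘
  order-˘ x y with compare x y
  ... | tri< x<y _ _ = from order≡gt x<y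
  ... | tri≈ _ refl _ = from order≡eq refl
  ... | tri> _ _ y<x = from order≡lt y<x

  upper-bound : ∀ x y → ∃[ z ] (x < z × y < z)
  upper-bound x y with compare x y
  ... | tri< x<y _ _ = let z , y<z = no-max y in z , <-trans x<y y<z , y<z
  ... | tri≈ _ refl _ = let z , x<z = no-max x in z , x<z , x<z
  ... | tri> _ _ y<x = let z , x<z = no-max x in z , x<z , <-trans y<x x<z

  lower-bound : ∀ x y → ∃[ z ] (z < x × z < y)
  lower-bound x y with compare x y
  ... | tri< x<y _ _ = let z , z<x = no-min x in z , z<x , <-trans z<x x<y
  ... | tri≈ _ refl _ = let z , z<x = no-min x in z , z<x , z<x
  ... | tri> _ _ y<x = let z , z<y = no-min y in z , <-trans z<y y<x , z<y

  eq-right-unit : ∀ {a x y} → order x y ≡ a ⇔ (∃[ z ] (order x z ≡ a × order z y ≡ eq))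
  eq-right-unit {y = y} = mk⇔
    (λ xy≡a → y , xy≡a , from order≡eq refl)
    (λ { (z , xz≡a , zy≡eq) → subst (λ w → order _ w ≡ _) (to order≡eq zy≡eq) xz≡a })

  eq-left-unit : ∀ {b x y} → order x y ≡ b ⇔ (∃[ z ] (order x z ≡ eq × order z y ≡ b))
  eq-left-unit {x = x} = mk⇔
    (λ xy≡b → x , from order≡eq refl , xy≡b)
    (λ { (z , xz≡eq , zy≡b) → subst (λ w → order w _ ≡ _) (sym (to order≡eq xz≡eq)) zy≡b })

  lt-dense : ∀ {x y} → order x y ≡ lt ⇔ (∃[ z ] (order x z ≡ lt × order z y ≡ lt))
  lt-dense = mk⇔
    (λ xy≡lt → let z , x<z , z<y = dense (to order≡lt xy≡lt) in
               z , from order≡lt x<z , from order≡lt z<y)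
    (λ { (z , xz≡lt , zy≡lt) → from order≡lt (<-trans (to order≡lt xz≡lt) (to order≡lt zy≡lt)) })

  gt-dense : ∀ {x y} → order x y ≡ gt ⇔ (∃[ z ] (order x z ≡ gt × order z y ≡ gt))
  gt-dense = mk⇔
    (λ xy≡gt → let z , y<z , z<x = dense (to order≡gt xy≡gt) in
               z , from order≡gt z<x , from order≡gt y<z)
    (λ { (z , xz≡gt , zy≡gt) → from order≡gt (<-trans (to order≡gt zy≡gt) (to order≡gt xz≡gt)) })

  order-⨾ : ∀ a b x y → order x y ∈ a ⨾ b ⇔ (∃[ z ] (order x z ≡ a × order z y ≡ b))
  order-⨾ a  eq _ _ = eq-right-unit ⇔-∘ x∈⁅y⁆⇔x≡y
  order-⨾ eq lt _ _ = eq-left-unit ⇔-∘ x∈⁅y⁆⇔x≡y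
  order-⨾ eq gt _ _ = eq-left-unit ⇔-∘ x∈⁅y⁆⇔x≡y
  order-⨾ lt lt _ _ = lt-dense ⇔-∘ x∈⁅y⁆⇔x≡y
  order-⨾ gt gt _ _ = gt-dense ⇔-∘ x∈⁅y⁆⇔x≡y
  order-⨾ lt gt x y = mk⇔
    (λ _ → let z , x<z , y<z = upper-bound x y in z , from order≡lt x<z , from order≡gt y<z)
    (λ _ → ∈⊤)
  order-⨾ gt lt x y = mk⇔
    (λ _ → let z , z<x , z<y = lower-bound x y in z , from order≡gt z<x , from order≡lt z<y)
    (λ _ → ∈⊤)

  order-surjective : ∀ a → ∃₂ λ x y → order x y ≡ a
  order-surjective lt = let z , x₀<z = no-max x₀ in x₀ , z , from order≡lt x₀<z
  order-surjective eq = x₀ , x₀ , from order≡eq refl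
  order-surjective gt = let z , x₀<z = no-max x₀ in z , x₀ , from order≡gt x₀<z

  order-isAtomRepresentation : IsAtomRepresentation pointAtoms order
  order-isAtomRepresentation = record
    { atom-surjective = order-surjective
    ; atom-⨾ = order-⨾
    ; atom-˘ = order-˘
    ; atom-ι = λ _ _ → order≡eq
    }

ℚ-no-max : ∀ p → ∃[ q ] p <ℚ q
ℚ-no-max p = p + 1ℚ , subst (_<ℚ p + 1ℚ) (ℚ.+-identityʳ p) (ℚ.+-monoʳ-< p (ℚ.positive⁻¹ 1ℚ))

ℚ-no-min : ∀ p → ∃[ q ] q <ℚ p
ℚ-no-min p = p - 1ℚ , subst (p - 1ℚ <ℚ_) (ℚ.+-identityʳ p) (ℚ.+-monoʳ-< p (ℚ.negative⁻¹ (-ℚ 1ℚ)))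

module ℚ-order = UnboundedDenseLinearOrder ℚ.<-isDenseLinearOrder 0ℚ ℚ-no-max ℚ-no-min

pointAlgebra : (sig : Signature) → Structure sig
pointAlgebra = ComplexAlgebra.complexAlgebra pointAtoms

module PointAlgebra (sig : Signature) where
  open Structure (pointAlgebra sig)
  open SubsetCode 3

  less equal : Fin 8
  less  = fromSubset ⁅ lt ⁆
  equal = fromSubset ⁅ eq ⁆

  decide-≤ : (i j : Fin 8) {_ : True (toSubset i ⊆? toSubset j)} → i ≤ j
  decide-≤ i j {i≤j} = toWitness i≤j

  decide-≰ : (i j : Fin 8) {_ : False (toSubset i ⊆? toSubset j)} → ¬ i ≤ j
  decide-≰ i j {i≰j} = toWitnessFalse i≰j

proposition13 : (sig : Signature) →
    Σ[ S ∈ Structure sig ] (Representable S × ¬ FinitelyRepresentable S)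
proposition13 sig =
  pointAlgebra sig ,
  (ℚ , _ , ComplexAlgebra.isRepresentation pointAtoms ℚ-order.order-isAtomRepresentation sig) ,
  no-finite-representation (pointAlgebra sig) less equal
    (decide-≤ less (less ∘ less)) (decide-≤ (less ∘ less) less)
    (decide-≤ less (equal ∘ less)) (decide-≤ (less ∘ equal) less)
    (decide-≤ equal (- less)) (decide-≰ less (- less))
  where
  open PointAlgebra sig
  open Structure (pointAlgebra sig) using (_∘_; -_)
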